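{- Let $\mathcal{F}$ be a family of directed graphs. The treewidths of the underlying undirected graphs of the graphs $G\in\mathcal{F}$ are bounded by a constant if and only if the treewidths of the graphs $\mathrm{Split}(G)$, $G\in\mathcal{F}$, are bounded by a constant.
   Context: For a directed graph $G$, $\mathrm{Split}(G)$ is the undirected graph with vertices $v_{in},v_{out}$ for each vertex $v$ of $G$, an edge $\{u_{out},v_{in}\}$ for each directed edge $(u,v)$ of $G$, and an edge $\{v_{in},v_{out}\}$ for each vertex $v$. Treewidth is defined via tree decompositions: a tree of bags (vertex subsets) covering all vertices and edges, the bags containing each vertex forming a connected subtree; width is max bag size minus one. -}

module Defs where

open import Data.Nat using (ℕ; zero; suc; _+_; _≤_)
open import Data.Fin using (Fin; toℕ; splitAt) renaming (zero to fzero; suc to fsuc)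
open import Data.Fin.Properties using (_≟_)
open import Data.Fin.Subset using (Subset; _∈_; ∣_∣)
open import Data.Bool using (Bool; true; false; _∨_)
open import Data.Sum using (_⊎_; inj₁; inj₂)
open import Data.Product using (Σ; _×_; ∃; ∃-syntax)
open import Relation.Binary.PropositionalEquality using (_≡_)
open import Relation.Nullary.Decidable using (⌊_⌋)

record Digraph : Set where
  field
    n   : ℕ
    arc : Fin n → Fin n → Bool
open Digraph public

-- A finite undirected graph on vertex set Fin n; adj u v ≡ true means {u,v} is an edge.
-- (adjacency is read as the set of unordered pairs {u,v} with adj u v ≡ true)
record Graph : Set where
  field
    size : ℕ
    adj  : Fin size → Fin size → Bool
open Graph public

Underlying : Digraph → Graph
Underlying G = record { size = n G ; adj = λ u v → arc G u v ∨ arc G v u }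

-- Split(G): vertices Fin (n + n); v_in = v ↑ˡ n (index v), v_out = n ↑ʳ v (index n + v).
-- Edges {u_out, v_in} for arcs (u,v), and {v_in, v_out} for each vertex v.
splitAdj : (G : Digraph) → Fin (n G + n G) → Fin (n G + n G) → Bool
splitAdj G a b with splitAt (n G) a | splitAt (n G) b
... | inj₁ u | inj₁ v = false
... | inj₂ u | inj₂ v = false
... | inj₂ u | inj₁ v = arc G u v ∨ ⌊ u ≟ v ⌋
... | inj₁ u | inj₂ v = arc G v u ∨ ⌊ u ≟ v ⌋

Split : Digraph → Graph
Split G = record { size = n G + n G ; adj = splitAdj G }

-- A finite tree on node set Fin (suc m), rooted at node 0, given by a parent
-- function: node (fsuc i) has parent (parent i) with a smaller index.
-- Every finite nonempty tree arises this way.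
record Tree : Set where
  field
    m        : ℕ
    parent   : Fin m → Fin (suc m)
    parent<  : ∀ i → toℕ (parent i) ≤ toℕ i
open Tree public

Node : Tree → Set
Node T = Fin (suc (m T))

TreeAdj : (T : Tree) → Node T → Node T → Set
TreeAdj T s t = ∃[ i ] ((s ≡ fsuc i × t ≡ parent T i) ⊎ (t ≡ fsuc i × s ≡ parent T i))

data Walk {A : Set} (R : A → A → Set) (P : A → Set) : A → A → Set where
  here : ∀ {x} → P x → Walk R P x x
  step : ∀ {x y z} → P x → R x y → Walk R P y z → Walk R P x z

record TreeDecomposition (H : Graph) : Set where
  field
    tree      : Tree
    bag       : Node tree → Subset (size H)
    covers-vertices : ∀ v → ∃[ t ] (v ∈ bag t)
    covers-edges    : ∀ u v → adj H u v ≡ true → ∃[ t ] (u ∈ bag t × v ∈ bag t)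
    connected       : ∀ v s t → v ∈ bag s → v ∈ bag t →
                      Walk (TreeAdj tree) (λ r → v ∈ bag r) s t
open TreeDecomposition public

HasWidth≤ : {H : Graph} → TreeDecomposition H → ℕ → Set
HasWidth≤ D k = ∀ t → ∣ bag D t ∣ ≤ suc k

Treewidth≤ : Graph → ℕ → Set
Treewidth≤ H k = Σ (TreeDecomposition H) (λ D → HasWidth≤ D k)

-- Both directions keep the tree of a given decomposition and only change the bags.
-- From tw(Underlying G) to tw(Split G): put both copies v_in, v_out of v wherever v
-- was; every edge of Split G joins copies of equal or adjacent vertices of G, so this
-- pulls the decomposition back along v_in, v_out ↦ v, at most doubling the bags.
-- Conversely, Underlying G is obtained from Split G by contracting the edges
-- {v_in, v_out}, and contracting connected fibres maps a tree decomposition to one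
-- of no larger width: a bag keeps the vertices some copy of which it contains.
module Submission where

open import Defs
open import Data.Nat using (ℕ; suc; _+_; _≤_; z≤n; s≤s)
open import Data.Nat.Properties using (≤-trans; ≤-reflexive; n≤1+n; +-suc; +-monoʳ-≤; +-mono-≤)
open import Data.Bool using (true; false; _∨_)
open import Data.Bool.Properties using (∨-zeroʳ; T-≡)
open import Data.Fin using (Fin; _↑ˡ_; _↑ʳ_; splitAt; join)
open import Data.Fin.Properties using (_≟_; splitAt-↑ˡ; splitAt-↑ʳ; join-splitAt)
open import Data.Fin.Subset using (Subset; _∈_; ∣_∣; _∪_; inside; outside)
open import Data.Fin.Subset.Properties using (x∈p∪q⁺; x∈p∪q⁻)
open import Data.Vec using ([]; _∷_; _++_; lookup; take; drop)
open import Data.Vec.Properties using ([]=⇒lookup; lookup⇒[]=; lookup-++ˡ; lookup-++ʳ; take++drop≡id)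
open import Data.Product using (∃-syntax; ∃₂; _×_; _,_)
open import Data.Sum using (_⊎_; inj₁; inj₂; [_,_]′; map₁; map₂)
open import Function using (id)
open import Function.Bundles using (_⇔_; mk⇔; Equivalence)
open import Relation.Binary.PropositionalEquality using (_≡_; refl; sym; trans; cong; subst; module ≡-Reasoning)
open import Relation.Nullary.Decidable using (⌊_⌋; toWitness; fromWitness)

open Equivalence using (to; from)

Edge : (H : Graph) → Fin (size H) → Fin (size H) → Set
Edge H u v = adj H u v ≡ true

∨-≡-true⁻ : ∀ x {y} → x ∨ y ≡ true → x ≡ true ⊎ y ≡ true
∨-≡-true⁻ true  _ = inj₁ refl
∨-≡-true⁻ false e = inj₂ e

∨-≟-true⁻ : ∀ x {n} {u v : Fin n} → x ∨ ⌊ u ≟ v ⌋ ≡ true → x ≡ true ⊎ u ≡ v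
∨-≟-true⁻ x e = map₂ (λ u≟v → toWitness (from T-≡ u≟v)) (∨-≡-true⁻ x e)

∨-≟-refl : ∀ x {n} (v : Fin n) → x ∨ ⌊ v ≟ v ⌋ ≡ true
∨-≟-refl x v = trans (cong (x ∨_) (to T-≡ (fromWitness refl))) (∨-zeroʳ x)

∣p++q∣≡∣p∣+∣q∣ : ∀ {m n} (p : Subset m) (q : Subset n) → ∣ p ++ q ∣ ≡ ∣ p ∣ + ∣ q ∣
∣p++q∣≡∣p∣+∣q∣ []            q = refl
∣p++q∣≡∣p∣+∣q∣ (inside  ∷ p) q = cong suc (∣p++q∣≡∣p∣+∣q∣ p q)
∣p++q∣≡∣p∣+∣q∣ (outside ∷ p) q = ∣p++q∣≡∣p∣+∣q∣ p q

∣p∪q∣≤∣p∣+∣q∣ : ∀ {n} (p q : Subset n) → ∣ p ∪ q ∣ ≤ ∣ p ∣ + ∣ q ∣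
∣p∪q∣≤∣p∣+∣q∣ []            []            = z≤n
∣p∪q∣≤∣p∣+∣q∣ (inside  ∷ p) (outside ∷ q) = s≤s (∣p∪q∣≤∣p∣+∣q∣ p q)
∣p∪q∣≤∣p∣+∣q∣ (inside  ∷ p) (inside  ∷ q) =
  s≤s (≤-trans (∣p∪q∣≤∣p∣+∣q∣ p q) (+-monoʳ-≤ ∣ p ∣ (n≤1+n ∣ q ∣)))
∣p∪q∣≤∣p∣+∣q∣ (outside ∷ p) (inside  ∷ q) =
  ≤-trans (s≤s (∣p∪q∣≤∣p∣+∣q∣ p q)) (≤-reflexive (sym (+-suc ∣ p ∣ ∣ q ∣)))
∣p∪q∣≤∣p∣+∣q∣ (outside ∷ p) (outside ∷ q) = ∣p∪q∣≤∣p∣+∣q∣ p q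

∈-resp-lookup : ∀ {m n} {p : Subset m} {q : Subset n} {i j} →
                lookup p i ≡ lookup q j → i ∈ p → j ∈ q
∈-resp-lookup {q = q} {j = j} e i∈p = lookup⇒[]= j q (trans (sym e) ([]=⇒lookup i∈p))

↑ˡ-∈-++ : ∀ {m n} (p : Subset m) (q : Subset n) {i} → i ↑ˡ n ∈ p ++ q ⇔ i ∈ p
↑ˡ-∈-++ p q {i} =
  mk⇔ (∈-resp-lookup (lookup-++ˡ p q i)) (∈-resp-lookup (sym (lookup-++ˡ p q i)))

↑ʳ-∈-++ : ∀ {m n} (p : Subset m) (q : Subset n) {j} → m ↑ʳ j ∈ p ++ q ⇔ j ∈ q
↑ʳ-∈-++ p q {j} =
  mk⇔ (∈-resp-lookup (lookup-++ʳ p q j)) (∈-resp-lookup (sym (lookup-++ʳ p q j)))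

↑ˡ-∈⇔∈-take : ∀ m {n} (p : Subset (m + n)) {i} → i ↑ˡ n ∈ p ⇔ i ∈ take m p
↑ˡ-∈⇔∈-take m {n} p {i} =
  subst (λ r → i ↑ˡ n ∈ r ⇔ i ∈ take m p) (take++drop≡id m p) (↑ˡ-∈-++ (take m p) (drop m p))

↑ʳ-∈⇔∈-drop : ∀ m {n} (p : Subset (m + n)) {j} → m ↑ʳ j ∈ p ⇔ j ∈ drop m p
↑ʳ-∈⇔∈-drop m p {j} =
  subst (λ r → m ↑ʳ j ∈ r ⇔ j ∈ drop m p) (take++drop≡id m p) (↑ʳ-∈-++ (take m p) (drop m p))

Walk-map : ∀ {A : Set} {R : A → A → Set} {P Q : A → Set} → (∀ {x} → P x → Q x) →
           ∀ {x y} → Walk R P x y → Walk R Q x y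
Walk-map f (here p)     = here (f p)
Walk-map f (step p r w) = step (f p) r (Walk-map f w)

Walk-++ : ∀ {A : Set} {R : A → A → Set} {P : A → Set} {x y z} →
          Walk R P x y → Walk R P y z → Walk R P x z
Walk-++ (here _)     w′ = w′
Walk-++ (step p r w) w′ = step p r (Walk-++ w w′)

module _ {H K : Graph} (D : TreeDecomposition H) where

  pullbackDecomposition :
    (f : Fin (size K) → Fin (size H)) →
    (∀ {a b} → Edge K a b → Edge H (f a) (f b) ⊎ f a ≡ f b) →
    (B : Node (tree D) → Subset (size K)) →
    (∀ {a t} → a ∈ B t ⇔ f a ∈ bag D t) →
    TreeDecomposition K
  pullbackDecomposition f f-edge B ∈B⇔ = record
    { tree            = tree D
    ; bag             = B
    ; covers-vertices = λ a → let (t , fa∈) = covers-vertices D (f a) in t , from ∈B⇔ fa∈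
    ; covers-edges    = covers-edges′
    ; connected       = λ a s t a∈s a∈t →
        Walk-map (from ∈B⇔) (connected D (f a) s t (to ∈B⇔ a∈s) (to ∈B⇔ a∈t))
    }
    where
    covers-edges′ : ∀ a b → Edge K a b → ∃[ t ] (a ∈ B t × b ∈ B t)
    covers-edges′ a b e with f-edge e
    ... | inj₁ fa-fb = let (t , fa∈ , fb∈) = covers-edges D (f a) (f b) fa-fb in
      t , from ∈B⇔ fa∈ , from ∈B⇔ fb∈
    ... | inj₂ fa≡fb = let (t , fa∈) = covers-vertices D (f a) in
      t , from ∈B⇔ fa∈ , from ∈B⇔ (subst (_∈ bag D t) fa≡fb fa∈)

module _ {H K : Graph} (D : TreeDecomposition K) where

  contractDecomposition :
    (g : Fin (size K) → Fin (size H)) →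
    (∀ u → ∃[ a ] g a ≡ u) →
    (∀ {u v} → Edge H u v → ∃₂ λ a b → g a ≡ u × g b ≡ v × Edge K a b) →
    (∀ {u a a′} → g a ≡ u → g a′ ≡ u → Walk (Edge K) (λ x → g x ≡ u) a a′) →
    (B : Node (tree D) → Subset (size H)) →
    (∀ {a t} → a ∈ bag D t → g a ∈ B t) →
    (∀ {u t} → u ∈ B t → ∃[ a ] (g a ≡ u × a ∈ bag D t)) →
    TreeDecomposition H
  contractDecomposition g g-onto g-edge fibre-connected B ∈B⁺ ∈B⁻ = record
    { tree            = tree D
    ; bag             = B
    ; covers-vertices = λ u →
        let (a , ga≡u) = g-onto u ; (t , a∈) = covers-vertices D a in t , image ga≡u a∈
    ; covers-edges    = λ u v e →
        let (a , b , ga≡u , gb≡v , ab) = g-edge e ; (t , a∈ , b∈) = covers-edges D a b ab in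
        t , image ga≡u a∈ , image gb≡v b∈
    ; connected       = λ u s t u∈s u∈t →
        let (a , ga≡u , a∈s) = ∈B⁻ u∈s ; (a′ , ga′≡u , a′∈t) = ∈B⁻ u∈t in
        lift (fibre-connected ga≡u ga′≡u) a∈s a′∈t
    }
    where
    image : ∀ {u a r} → g a ≡ u → a ∈ bag D r → u ∈ B r
    image {r = r} ga≡u a∈r = subst (_∈ B r) ga≡u (∈B⁺ a∈r)

    lift : ∀ {u a a′ s t} → Walk (Edge K) (λ x → g x ≡ u) a a′ → a ∈ bag D s → a′ ∈ bag D t →
           Walk (TreeAdj (tree D)) (λ r → u ∈ B r) s t
    lift {a = a} {s = s} {t} (here ga≡u) a∈s a∈t =
      Walk-map (image ga≡u) (connected D a s t a∈s a∈t)
    lift {a = a} {s = s} (step ga≡u ab w) a∈s a′∈t =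
      let (r , a∈r , b∈r) = covers-edges D a _ ab in
      Walk-++ (Walk-map (image ga≡u) (connected D a s r a∈s a∈r)) (lift w b∈r a′∈t)

data Copy (N : ℕ) : Fin (N + N) → Set where
  inCopy  : ∀ v → Copy N (v ↑ˡ N)
  outCopy : ∀ v → Copy N (N ↑ʳ v)

copy : ∀ {N} a → Copy N a
copy {N} a = subst (Copy N) (join-splitAt N N a) (copy-join (splitAt N a))
  where
  copy-join : ∀ x → Copy N (join N N x)
  copy-join (inj₁ v) = inCopy v
  copy-join (inj₂ v) = outCopy v

original : ∀ N → Fin (N + N) → Fin N
original N a = [ id , id ]′ (splitAt N a)

original-in : ∀ {N} v → original N (v ↑ˡ N) ≡ v
original-in {N} v = cong [ id , id ]′ (splitAt-↑ˡ N v N)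

original-out : ∀ {N} v → original N (N ↑ʳ v) ≡ v
original-out {N} v = cong [ id , id ]′ (splitAt-↑ʳ N N v)

copies : ∀ {N a v} → original N a ≡ v → a ≡ v ↑ˡ N ⊎ a ≡ N ↑ʳ v
copies {N} {a} a↦v with copy {N} a
... | inCopy u  = inj₁ (cong (_↑ˡ _) (trans (sym (original-in u)) a↦v))
... | outCopy u = inj₂ (cong (_ ↑ʳ_) (trans (sym (original-out u)) a↦v))

∈-doubled⇔ : ∀ {N} (p : Subset N) a → a ∈ p ++ p ⇔ original N a ∈ p
∈-doubled⇔ {N} p a with copy {N} a
... | inCopy v  rewrite original-in v  = ↑ˡ-∈-++ p p
... | outCopy v rewrite original-out v = ↑ʳ-∈-++ p p

merged : ∀ N → Subset (N + N) → Subset N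
merged N p = take N p ∪ drop N p

∣merged∣≤∣p∣ : ∀ N (p : Subset (N + N)) → ∣ merged N p ∣ ≤ ∣ p ∣
∣merged∣≤∣p∣ N p = ≤-trans (∣p∪q∣≤∣p∣+∣q∣ (take N p) (drop N p)) (≤-reflexive (begin
  ∣ take N p ∣ + ∣ drop N p ∣ ≡⟨ ∣p++q∣≡∣p∣+∣q∣ (take N p) (drop N p) ⟨
  ∣ take N p ++ drop N p ∣    ≡⟨ cong ∣_∣ (take++drop≡id N p) ⟩
  ∣ p ∣                       ∎))
  where open ≡-Reasoning

∈-merged⁺ : ∀ {N} (p : Subset (N + N)) {a} → a ∈ p → original N a ∈ merged N p
∈-merged⁺ {N} p {a} a∈p with copy {N} a
... | inCopy v  rewrite original-in v  = x∈p∪q⁺ (inj₁ (to (↑ˡ-∈⇔∈-take N p) a∈p))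
... | outCopy v rewrite original-out v = x∈p∪q⁺ (inj₂ (to (↑ʳ-∈⇔∈-drop N p) a∈p))

∈-merged⁻ : ∀ {N} (p : Subset (N + N)) {v} → v ∈ merged N p → ∃[ a ] (original N a ≡ v × a ∈ p)
∈-merged⁻ {N} p {v} v∈ with x∈p∪q⁻ (take N p) (drop N p) v∈
... | inj₁ v∈take = v ↑ˡ N , original-in v , from (↑ˡ-∈⇔∈-take N p) v∈take
... | inj₂ v∈drop = N ↑ʳ v , original-out v , from (↑ʳ-∈⇔∈-drop N p) v∈drop

module _ (G : Digraph) where

  private
    N = n G

  split-out-in : ∀ u v → adj (Split G) (N ↑ʳ u) (v ↑ˡ N) ≡ arc G u v ∨ ⌊ u ≟ v ⌋
  split-out-in u v rewrite splitAt-↑ʳ N N u | splitAt-↑ˡ N v N = refl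

  split-in-out : ∀ u v → adj (Split G) (u ↑ˡ N) (N ↑ʳ v) ≡ arc G v u ∨ ⌊ u ≟ v ⌋
  split-in-out u v rewrite splitAt-↑ˡ N u N | splitAt-↑ʳ N N v = refl

  split-in-in : ∀ u v → adj (Split G) (u ↑ˡ N) (v ↑ˡ N) ≡ false
  split-in-in u v rewrite splitAt-↑ˡ N u N | splitAt-↑ˡ N v N = refl

  split-out-out : ∀ u v → adj (Split G) (N ↑ʳ u) (N ↑ʳ v) ≡ false
  split-out-out u v rewrite splitAt-↑ʳ N N u | splitAt-↑ʳ N N v = refl

  split-arc : ∀ {u v} → arc G u v ≡ true → Edge (Split G) (N ↑ʳ u) (v ↑ˡ N)
  split-arc {u} {v} uv = trans (split-out-in u v) (cong (_∨ _) uv)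

  split-arcʳ : ∀ {u v} → arc G v u ≡ true → Edge (Split G) (u ↑ˡ N) (N ↑ʳ v)
  split-arcʳ {u} {v} vu = trans (split-in-out u v) (cong (_∨ _) vu)

  split-in-out-self : ∀ v → Edge (Split G) (v ↑ˡ N) (N ↑ʳ v)
  split-in-out-self v = trans (split-in-out v v) (∨-≟-refl (arc G v v) v)

  split-out-in-self : ∀ v → Edge (Split G) (N ↑ʳ v) (v ↑ˡ N)
  split-out-in-self v = trans (split-out-in v v) (∨-≟-refl (arc G v v) v)

  Underlying-arc : ∀ {u v} → arc G u v ≡ true → Edge (Underlying G) u v
  Underlying-arc {u} {v} uv = cong (_∨ arc G v u) uv

  Underlying-arcʳ : ∀ {u v} → arc G v u ≡ true → Edge (Underlying G) u v
  Underlying-arcʳ {u} {v} vu = trans (cong (arc G u v ∨_) vu) (∨-zeroʳ _)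

  Split-edge⇒Underlying-edge : ∀ {a b} → Edge (Split G) a b →
    Edge (Underlying G) (original N a) (original N b) ⊎ original N a ≡ original N b
  Split-edge⇒Underlying-edge {a} {b} ab with copy {N} a | copy {N} b
  ... | inCopy u  | inCopy v  with () ← trans (sym (split-in-in u v)) ab
  ... | outCopy u | outCopy v with () ← trans (sym (split-out-out u v)) ab
  ... | outCopy u | inCopy v  rewrite original-out u | original-in v =
    map₁ Underlying-arc (∨-≟-true⁻ (arc G u v) (trans (sym (split-out-in u v)) ab))
  ... | inCopy u  | outCopy v rewrite original-in u | original-out v =
    map₁ Underlying-arcʳ (∨-≟-true⁻ (arc G v u) (trans (sym (split-in-out u v)) ab))

  Underlying-edge⇒Split-edge : ∀ {u v} → Edge (Underlying G) u v →
    ∃₂ λ a b → original N a ≡ u × original N b ≡ v × Edge (Split G) a b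
  Underlying-edge⇒Split-edge {u} {v} uv with ∨-≡-true⁻ (arc G u v) uv
  ... | inj₁ u→v = N ↑ʳ u , v ↑ˡ N , original-out u , original-in v , split-arc u→v
  ... | inj₂ v→u = u ↑ˡ N , N ↑ʳ v , original-in u , original-out v , split-arcʳ v→u

  copies-connected : ∀ {v a a′} → original N a ≡ v → original N a′ ≡ v →
    Walk (Edge (Split G)) (λ x → original N x ≡ v) a a′
  copies-connected {v} a↦v a′↦v with copies a↦v | copies a′↦v
  ... | inj₁ refl | inj₁ refl = here a↦v
  ... | inj₁ refl | inj₂ refl = step a↦v (split-in-out-self v) (here a′↦v)
  ... | inj₂ refl | inj₁ refl = step a↦v (split-out-in-self v) (here a′↦v)
  ... | inj₂ refl | inj₂ refl = here a↦v

  treewidth-Split≤ : ∀ {k} → Treewidth≤ (Underlying G) k → Treewidth≤ (Split G) (k + suc k)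
  treewidth-Split≤ (D , width≤) =
    pullbackDecomposition D (original N) Split-edge⇒Underlying-edge
      (λ t → bag D t ++ bag D t) (λ {a} {t} → ∈-doubled⇔ (bag D t) a) ,
    λ t → ≤-trans (≤-reflexive (∣p++q∣≡∣p∣+∣q∣ (bag D t) (bag D t)))
                  (+-mono-≤ (width≤ t) (width≤ t))

  treewidth-Underlying≤ : ∀ {k} → Treewidth≤ (Split G) k → Treewidth≤ (Underlying G) k
  treewidth-Underlying≤ (D , width≤) =
    contractDecomposition D (original N) (λ v → v ↑ˡ N , original-in v)
      Underlying-edge⇒Split-edge copies-connected
      (λ t → merged N (bag D t)) (∈-merged⁺ _) (∈-merged⁻ _) ,
    λ t → ≤-trans (∣merged∣≤∣p∣ N (bag D t)) (width≤ t)

propositionB1 : (𝓕 : Digraph → Set) →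
    (∃[ k ] (∀ G → 𝓕 G → Treewidth≤ (Underlying G) k)) ⇔
    (∃[ k ] (∀ G → 𝓕 G → Treewidth≤ (Split G) k))
propositionB1 𝓕 = mk⇔
  (λ (k , tw≤) → k + suc k , λ G G∈𝓕 → treewidth-Split≤ G (tw≤ G G∈𝓕))
  (λ (k , tw≤) → k , λ G G∈𝓕 → treewidth-Underlying≤ G (tw≤ G G∈𝓕))
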